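{- Let $D$ be a downward-closed family of subsets of $[n]$ (viewed as a subset of $\{0,1\}^n$), and let $\phi:D\to D$ satisfy $\phi(a)\subseteq a$ for all $a\in D$. Then the functions \[\prod_{i\in\phi(a)}x_i\prod_{i\in a\setminus\phi(a)}(1+x_i),\qquad a\in D,\] restricted to $D$, form a basis of the vector space $\{f:D\to GF(2)\}$.
   Context: A family $D$ is downward-closed if $b\subseteq a\in D$ implies $b\in D$. Subsets of $[n]$ are identified with their indicator vectors in $\{0,1\}^n$. Empty products equal $1$. -}

module Defs where

open import Data.Nat using (ℕ; zero; suc)
open import Data.Bool using (Bool; true; false; _∧_; _xor_; not; if_then_else_; T)
open import Data.Fin using (Fin)
import Data.Fin as Fin
open import Data.Vec using (Vec; []; _∷_; lookup)
open import Data.List using (List; []; _∷_; map; _++_; foldr)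
open import Data.Fin.Subset using (Subset; _⊆_)
open import Data.Product using (_×_; ∃)
open import Relation.Binary.PropositionalEquality using (_≡_)

-- GF(2) is modelled by Bool: addition = _xor_, multiplication = _∧_,
-- 0 = false, 1 = true.  A subset of [n] is its indicator vector (Subset n = Vec Bool n).

∏ : (n : ℕ) → (Fin n → Bool) → Bool
∏ zero    f = true
∏ (suc n) f = f Fin.zero ∧ ∏ n (λ i → f (Fin.suc i))

Σ : List Bool → Bool
Σ = foldr _xor_ false

allSubsets : (n : ℕ) → List (Subset n)
allSubsets zero    = [] ∷ []
allSubsets (suc n) = map (false ∷_) (allSubsets n) ++ map (true ∷_) (allSubsets n)

DownwardClosed : {n : ℕ} → (Subset n → Bool) → Set
DownwardClosed D = ∀ a b → b ⊆ a → T (D a) → T (D b)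

-- The function  x ↦ ∏_{i∈p} x_i ∏_{i∈a∖p} (1 + x_i)   (here p = φ(a)).
monoFun : {n : ℕ} → (a p : Subset n) → Subset n → Bool
monoFun {n} a p x =
  ∏ n (λ i → if lookup p i then lookup x i
             else (if lookup a i then not (lookup x i) else true))

linComb : {n : ℕ} → (D : Subset n → Bool) → (φ : Subset n → Subset n)
        → (c : Subset n → Bool) → Subset n → Bool
linComb {n} D φ c x =
  Σ (map (λ a → D a ∧ (c a ∧ monoFun a (φ a) x)) (allSubsets n))

IsBasisOnD : {n : ℕ} → (D : Subset n → Bool) → (φ : Subset n → Subset n) → Set
IsBasisOnD D φ =
  ((g : ∀ x → T (D x) → Bool) →
     ∃ (λ (c : Subset _ → Bool) → ∀ x → (dx : T (D x)) → linComb D φ c x ≡ g x dx))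
  ×
  ((c : _ → Bool) → (∀ x → T (D x) → linComb D φ c x ≡ false) →
     ∀ a → T (D a) → c a ≡ false)

module Submission where

-- Induction on n, splitting D by the first coordinate x₀ into D₀ = {a : 0∷a ∈ D} and
-- D₁ = {a : 1∷a ∈ D}; downward closure gives D₁ ⊆ D₀.  For a = 0∷a' we have φ(a) ⊆ a, so
-- f_a(x₀∷x) = f_{a'}(x) (the function of a' in dimension n − 1, with φ restricted) does not
-- depend on x₀; for a = 1∷a' it is f_{a'}(x) times x₀ or 1 + x₀, and these two factors sum
-- to 1.  Hence a combination Σ c(a) f_a evaluated at x₀∷x reads L₀(x) + M(x₀, x) with
-- M(0, x) + M(1, x) = L₁(x), where L₀, L₁ are combinations of the functions for D₀, D₁.
-- Prescribing values on D is therefore the same as prescribing L₁ on D₁ and then L₀ on D₀,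
-- and by induction both problems have exactly one solution.

open import Defs
open import Algebra.Bundles using (CommutativeRing)
open import Data.Nat using (ℕ; zero; suc)
open import Data.Bool using (Bool; true; false; T; _∧_; _xor_; not; if_then_else_)
open import Data.Bool.Properties
  using (∧-assoc; ∧-identityʳ; ∧-zeroʳ; ∧-distribˡ-xor; ∧-distribʳ-xor;
         xor-assoc; xor-identityʳ; xor-same; xor-∧-commutativeRing)
open import Algebra.Properties.CommutativeSemigroup
  (CommutativeRing.+-commutativeSemigroup xor-∧-commutativeRing) using (interchange)
open import Data.Fin.Subset using (Subset; _⊆_)
open import Data.Fin.Subset.Properties using (s⊆s; out⊆; drop-∷-⊆)
open import Data.Vec using ([]; _∷_; head; tail; here)
open import Data.List using (List; []; _∷_; map; _++_)
open import Data.List.Properties using (map-++; map-∘; map-cong)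
open import Data.Product using (_×_; _,_; ∃; proj₁; proj₂)
open import Data.Unit using (tt)
open import Function using (_∘_)
open import Relation.Binary.PropositionalEquality

∧-congˡ-T : ∀ d {u v} → (T d → u ≡ v) → d ∧ u ≡ d ∧ v
∧-congˡ-T true  u≡v = u≡v tt
∧-congˡ-T false u≡v = refl

T-∧≡false : ∀ {d c} → T d → d ∧ c ≡ false → c ≡ false
T-∧≡false {true} _ c≡false = c≡false

xor≡false⇒≡ : ∀ x y → x xor y ≡ false → x ≡ y
xor≡false⇒≡ false false _ = refl
xor≡false⇒≡ true  true  _ = refl

xor-cancelˡ : ∀ x y → x xor (x xor y) ≡ y
xor-cancelˡ x y = begin
  x xor (x xor y)  ≡⟨ xor-assoc x x y ⟨
  (x xor x) xor y  ≡⟨ cong (_xor y) (xor-same x) ⟩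
  y                ∎
  where open ≡-Reasoning

xor-cancelʳ : ∀ x y → (x xor y) xor y ≡ x
xor-cancelʳ x y = begin
  (x xor y) xor y  ≡⟨ xor-assoc x y y ⟩
  x xor (y xor y)  ≡⟨ cong (x xor_) (xor-same y) ⟩
  x xor false      ≡⟨ xor-identityʳ x ⟩
  x                ∎
  where open ≡-Reasoning

Σ-++ : ∀ xs ys → Σ (xs ++ ys) ≡ Σ xs xor Σ ys
Σ-++ []       ys = refl
Σ-++ (x ∷ xs) ys = trans (cong (x xor_) (Σ-++ xs ys)) (sym (xor-assoc x (Σ xs) (Σ ys)))

Σ-map-xor : {A : Set} (F G : A → Bool) (as : List A) →
            Σ (map (λ a → F a xor G a) as) ≡ Σ (map F as) xor Σ (map G as)
Σ-map-xor F G []       = refl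
Σ-map-xor F G (a ∷ as) =
  trans (cong ((F a xor G a) xor_) (Σ-map-xor F G as))
        (interchange (F a) (G a) (Σ (map F as)) (Σ (map G as)))

Σ-allSubsets-suc : ∀ n (F : Subset (suc n) → Bool) →
  Σ (map F (allSubsets (suc n)))
    ≡ Σ (map (F ∘ (false ∷_)) (allSubsets n)) xor Σ (map (F ∘ (true ∷_)) (allSubsets n))
Σ-allSubsets-suc n F = begin
  Σ (map F (map (false ∷_) as ++ map (true ∷_) as))
    ≡⟨ cong Σ (map-++ F (map (false ∷_) as) (map (true ∷_) as)) ⟩
  Σ (map F (map (false ∷_) as) ++ map F (map (true ∷_) as))
    ≡⟨ Σ-++ (map F (map (false ∷_) as)) (map F (map (true ∷_) as)) ⟩
  Σ (map F (map (false ∷_) as)) xor Σ (map F (map (true ∷_) as))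
    ≡⟨ sym (cong₂ (λ u v → Σ u xor Σ v) (map-∘ as) (map-∘ as)) ⟩
  Σ (map (F ∘ (false ∷_)) as) xor Σ (map (F ∘ (true ∷_)) as) ∎
  where
  open ≡-Reasoning
  as = allSubsets n

monoFun-∷ : ∀ {n} a₀ (a : Subset n) p x₀ x →
  monoFun (a₀ ∷ a) p (x₀ ∷ x)
    ≡ (if head p then x₀ else (if a₀ then not x₀ else true)) ∧ monoFun a (tail p) x
monoFun-∷ a₀ a (_ ∷ p) x₀ x = refl

module _ {n : ℕ} (D : Subset n → Bool) (φ : Subset n → Subset n) where

  linComb-congᶜ : ∀ {c c'} → (∀ a → T (D a) → c a ≡ c' a) → ∀ x →
                  linComb D φ c x ≡ linComb D φ c' x
  linComb-congᶜ c≡c' x =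
    cong Σ (map-cong (λ a → ∧-congˡ-T (D a) (cong (_∧ _) ∘ c≡c' a)) (allSubsets n))

  linComb-xor : ∀ c c' x →
    linComb D φ (λ a → c a xor c' a) x ≡ linComb D φ c x xor linComb D φ c' x
  linComb-xor c c' x = trans
    (cong Σ (map-cong distrib (allSubsets n)))
    (Σ-map-xor (λ a → D a ∧ (c a ∧ f a)) (λ a → D a ∧ (c' a ∧ f a)) (allSubsets n))
    where
    f : Subset n → Bool
    f a = monoFun a (φ a) x
    distrib : ∀ a → D a ∧ ((c a xor c' a) ∧ f a) ≡ (D a ∧ (c a ∧ f a)) xor (D a ∧ (c' a ∧ f a))
    distrib a = trans (cong (D a ∧_) (∧-distribʳ-xor (f a) (c a) (c' a))) (∧-distribˡ-xor (D a) _ _)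

  linComb-vanishes : ∀ {c} → (∀ a → T (D a) → c a ≡ false) → ∀ x → linComb D φ c x ≡ false
  linComb-vanishes c≡0 x = trans (linComb-congᶜ c≡0 x) (Σ-map-false (allSubsets n))
    where
    Σ-map-false : (as : List (Subset n)) →
                  Σ (map (λ a → D a ∧ (false ∧ monoFun a (φ a) x)) as) ≡ false
    Σ-map-false []       = refl
    Σ-map-false (a ∷ as) = cong₂ _xor_ (∧-zeroʳ (D a)) (Σ-map-false as)

Spans : {n : ℕ} → (Subset n → Bool) → (Subset n → Subset n) → Set
Spans D φ = (g : ∀ x → T (D x) → Bool) →
  ∃ (λ (c : Subset _ → Bool) → ∀ x → (dx : T (D x)) → linComb D φ c x ≡ g x dx)

Independent : {n : ℕ} → (Subset n → Bool) → (Subset n → Subset n) → Set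
Independent D φ = (c : _ → Bool) → (∀ x → T (D x) → linComb D φ c x ≡ false) →
  ∀ a → T (D a) → c a ≡ false

module _ (D : Subset 0 → Bool) (φ : Subset 0 → Subset 0) where

  linComb-[] : ∀ c → linComb D φ c [] ≡ D [] ∧ c []
  linComb-[] c =
    trans (xor-identityʳ (D [] ∧ (c [] ∧ true))) (cong (D [] ∧_) (∧-identityʳ (c [])))

  spans-[] : Spans D φ
  spans-[] g = c , λ { [] d → trans (linComb-[] c) (choose-fits d) }
    where
    choose : (d : Bool) → (T d → Bool) → Bool
    choose true  k = k tt
    choose false _ = false
    choose-fits : ∀ {d k} (t : T d) → d ∧ choose d k ≡ k t
    choose-fits {true} tt = refl
    c : Subset 0 → Bool
    c _ = choose (D []) (g [])

  independent-[] : Independent D φ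
  independent-[] c vanishes [] d = T-∧≡false d (trans (sym (linComb-[] c)) (vanishes [] d))

module FirstCoordinate {n : ℕ} (D : Subset (suc n) → Bool) (φ : Subset (suc n) → Subset (suc n))
       (closed : DownwardClosed D) (shrinks : ∀ a → T (D a) → φ a ⊆ a) where

  D₀ D₁ : Subset n → Bool
  D₀ a = D (false ∷ a)
  D₁ a = D (true ∷ a)

  φ₀ φ₁ : Subset n → Subset n
  φ₀ a = tail (φ (false ∷ a))
  φ₁ a = tail (φ (true ∷ a))

  closed₀ : DownwardClosed D₀
  closed₀ a b b⊆a = closed (false ∷ a) (false ∷ b) (s⊆s b⊆a)

  closed₁ : DownwardClosed D₁
  closed₁ a b b⊆a = closed (true ∷ a) (true ∷ b) (s⊆s b⊆a)

  D₁⊆D₀ : ∀ a → T (D₁ a) → T (D₀ a)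
  D₁⊆D₀ a = closed (true ∷ a) (false ∷ a) (out⊆ (λ i∈a → i∈a))

  tail⊆ : ∀ a₀ a → T (D (a₀ ∷ a)) → tail (φ (a₀ ∷ a)) ⊆ a
  tail⊆ a₀ a d with φ (a₀ ∷ a) | shrinks (a₀ ∷ a) d
  ... | _ ∷ _ | p⊆a = drop-∷-⊆ p⊆a

  shrinks₀ : ∀ a → T (D₀ a) → φ₀ a ⊆ a
  shrinks₀ = tail⊆ false

  shrinks₁ : ∀ a → T (D₁ a) → φ₁ a ⊆ a
  shrinks₁ = tail⊆ true

  head-φ₀ : ∀ a → T (D₀ a) → head (φ (false ∷ a)) ≡ false
  head-φ₀ a d with φ (false ∷ a) | shrinks (false ∷ a) d
  ... | false ∷ _ | _   = refl
  ... | true  ∷ _ | p⊆a with p⊆a here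
  ...                     | ()

  -- Absorbs into the coefficient of a the factor x₀ or 1 + x₀ that the first coordinate
  -- contributes to f_{1∷a}.
  twisted : (Subset n → Bool) → Bool → Subset n → Bool
  twisted c₁ x₀ a = c₁ a ∧ (if head (φ (true ∷ a)) then x₀ else not x₀)

  M : (Subset n → Bool) → Bool → Subset n → Bool
  M c₁ x₀ = linComb D₁ φ₁ (twisted c₁ x₀)

  linComb-∷ : ∀ c x₀ x →
    linComb D φ c (x₀ ∷ x) ≡ linComb D₀ φ₀ (c ∘ (false ∷_)) x xor M (c ∘ (true ∷_)) x₀ x
  linComb-∷ c x₀ x = trans (Σ-allSubsets-suc n _)
    (cong₂ _xor_ (cong Σ (map-cong term₀ (allSubsets n))) (cong Σ (map-cong term₁ (allSubsets n))))
    where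
    term₀ : ∀ a → D (false ∷ a) ∧ (c (false ∷ a) ∧ monoFun (false ∷ a) (φ (false ∷ a)) (x₀ ∷ x))
                ≡ D₀ a ∧ (c (false ∷ a) ∧ monoFun a (φ₀ a) x)
    term₀ a = ∧-congˡ-T (D₀ a) λ d → cong (c (false ∷ a) ∧_)
      (trans (monoFun-∷ false a (φ (false ∷ a)) x₀ x)
             (cong (λ h → (if h then x₀ else true) ∧ monoFun a (φ₀ a) x) (head-φ₀ a d)))
    twist : Subset n → Bool
    twist a = if head (φ (true ∷ a)) then x₀ else not x₀
    term₁ : ∀ a → D (true ∷ a) ∧ (c (true ∷ a) ∧ monoFun (true ∷ a) (φ (true ∷ a)) (x₀ ∷ x))
                ≡ D₁ a ∧ (twisted (c ∘ (true ∷_)) x₀ a ∧ monoFun a (φ₁ a) x)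
    term₁ a = cong (D₁ a ∧_) (trans (cong (c (true ∷ a) ∧_) (monoFun-∷ true a (φ (true ∷ a)) x₀ x))
                                    (sym (∧-assoc (c (true ∷ a)) (twist a) (monoFun a (φ₁ a) x))))

  M-false-xor-true : ∀ c₁ x → M c₁ false x xor M c₁ true x ≡ linComb D₁ φ₁ c₁ x
  M-false-xor-true c₁ x =
    trans (sym (linComb-xor D₁ φ₁ (twisted c₁ false) (twisted c₁ true) x))
          (linComb-congᶜ D₁ φ₁ (λ a _ → untwist (c₁ a) (head (φ (true ∷ a)))) x)
    where
    untwist : ∀ c h → (c ∧ (if h then false else true)) xor (c ∧ (if h then true else false)) ≡ c
    untwist false _     = refl
    untwist true  false = refl
    untwist true  true  = refl

  M-vanishes : ∀ {c₁} → (∀ a → T (D₁ a) → c₁ a ≡ false) → ∀ x₀ x → M c₁ x₀ x ≡ false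
  M-vanishes c₁≡0 x₀ = linComb-vanishes D₁ φ₁ (λ a d → cong (_∧ _) (c₁≡0 a d))

  spans-∷ : Spans D₀ φ₀ → Spans D₁ φ₁ → Spans D φ
  spans-∷ spans₀ spans₁ g with spans₁ (λ x d → g (false ∷ x) (D₁⊆D₀ x d) xor g (true ∷ x) d)
  ... | c₁ , fits₁ with spans₀ (λ x d → g (false ∷ x) d xor M c₁ false x)
  ...   | c₀ , fits₀ = c , fits
    where
    c : Subset (suc n) → Bool
    c (false ∷ a) = c₀ a
    c (true  ∷ a) = c₁ a
    fits : ∀ x (dx : T (D x)) → linComb D φ c x ≡ g x dx
    fits (false ∷ x) dx = begin
      linComb D φ c (false ∷ x)                            ≡⟨ linComb-∷ c false x ⟩
      linComb D₀ φ₀ c₀ x xor M c₁ false x                  ≡⟨ cong (_xor M c₁ false x) (fits₀ x dx) ⟩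
      (g (false ∷ x) dx xor M c₁ false x) xor M c₁ false x ≡⟨ xor-cancelʳ _ _ ⟩
      g (false ∷ x) dx                                     ∎
      where open ≡-Reasoning
    fits (true ∷ x) dx = begin
      linComb D φ c (true ∷ x)               ≡⟨ linComb-∷ c true x ⟩
      linComb D₀ φ₀ c₀ x xor M c₁ true x     ≡⟨ cong (_xor M c₁ true x) (fits₀ x (D₁⊆D₀ x dx)) ⟩
      (g₀ xor M c₁ false x) xor M c₁ true x  ≡⟨ xor-assoc g₀ _ _ ⟩
      g₀ xor (M c₁ false x xor M c₁ true x)  ≡⟨ cong (g₀ xor_) (M-false-xor-true c₁ x) ⟩
      g₀ xor linComb D₁ φ₁ c₁ x              ≡⟨ cong (g₀ xor_) (fits₁ x dx) ⟩
      g₀ xor (g₀ xor g (true ∷ x) dx)        ≡⟨ xor-cancelˡ g₀ _ ⟩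
      g (true ∷ x) dx                        ∎
      where
      open ≡-Reasoning
      g₀ = g (false ∷ x) (D₁⊆D₀ x dx)

  independent-∷ : Independent D₀ φ₀ → Independent D₁ φ₁ → Independent D φ
  independent-∷ independent₀ independent₁ c vanishes = vanishes-on-D
    where
    c₀ c₁ : Subset n → Bool
    c₀ = c ∘ (false ∷_)
    c₁ = c ∘ (true ∷_)
    L₀ : Subset n → Bool
    L₀ = linComb D₀ φ₀ c₀
    vanishes-∷ : ∀ x₀ x → T (D (x₀ ∷ x)) → L₀ x xor M c₁ x₀ x ≡ false
    vanishes-∷ x₀ x d = trans (sym (linComb-∷ c x₀ x)) (vanishes (x₀ ∷ x) d)
    M≡L₀ : ∀ x₀ x → T (D (x₀ ∷ x)) → M c₁ x₀ x ≡ L₀ x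
    M≡L₀ x₀ x d = sym (xor≡false⇒≡ (L₀ x) _ (vanishes-∷ x₀ x d))
    -- On D₁ both 0∷x and 1∷x lie in D, so M c₁ 0 x and M c₁ 1 x both equal L₀ x.
    L₁-vanishes : ∀ x → T (D₁ x) → linComb D₁ φ₁ c₁ x ≡ false
    L₁-vanishes x d = begin
      linComb D₁ φ₁ c₁ x            ≡⟨ M-false-xor-true c₁ x ⟨
      M c₁ false x xor M c₁ true x  ≡⟨ cong (_xor M c₁ true x) (M≡L₀ false x (D₁⊆D₀ x d)) ⟩
      L₀ x xor M c₁ true x          ≡⟨ vanishes-∷ true x d ⟩
      false                         ∎
      where open ≡-Reasoning
    c₁-vanishes : ∀ a → T (D₁ a) → c₁ a ≡ false
    c₁-vanishes = independent₁ c₁ L₁-vanishes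
    L₀-vanishes : ∀ x → T (D₀ x) → L₀ x ≡ false
    L₀-vanishes x d = begin
      L₀ x                    ≡⟨ xor-identityʳ (L₀ x) ⟨
      L₀ x xor false          ≡⟨ cong (L₀ x xor_) (M-vanishes c₁-vanishes false x) ⟨
      L₀ x xor M c₁ false x   ≡⟨ vanishes-∷ false x d ⟩
      false                   ∎
      where open ≡-Reasoning
    vanishes-on-D : ∀ a → T (D a) → c a ≡ false
    vanishes-on-D (false ∷ a) = independent₀ c₀ L₀-vanishes a
    vanishes-on-D (true  ∷ a) = c₁-vanishes a

basis : ∀ n (D : Subset n → Bool) (φ : Subset n → Subset n) → DownwardClosed D →
        (∀ a → T (D a) → φ a ⊆ a) → Spans D φ × Independent D φ
basis zero    D φ _      _       = spans-[] D φ , independent-[] D φ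
basis (suc n) D φ closed shrinks =
  spans-∷ (proj₁ basis₀) (proj₁ basis₁) , independent-∷ (proj₂ basis₀) (proj₂ basis₁)
  where
  open FirstCoordinate D φ closed shrinks
  basis₀ : Spans D₀ φ₀ × Independent D₀ φ₀
  basis₀ = basis n D₀ φ₀ closed₀ shrinks₀
  basis₁ : Spans D₁ φ₁ × Independent D₁ φ₁
  basis₁ = basis n D₁ φ₁ closed₁ shrinks₁

lemma13 : (n : ℕ) (D : Subset n → Bool) (φ : Subset n → Subset n)
          → DownwardClosed D
          → (∀ a → T (D a) → T (D (φ a)))
          → (∀ a → T (D a) → φ a ⊆ a)
          → IsBasisOnD D φ
lemma13 n D φ closed _ shrinks = basis n D φ closed shrinks
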